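{- Let $(\mathcal A_n)_{n\in\mathbb N}$ be a sequence of finiteness spaces such that $\mathcal A_n\preceq\mathcal A_{n+1}$ for all $n$. Then $\bigcup_{n\in\mathbb N}\mathfrak F(\mathcal A_n)$ is a finiteness structure on $\bigcup_{n\in\mathbb N}|\mathcal A_n|$; that is, the supremum $\bigsqcup_n\mathcal A_n$ is exact.
   Context: For $\mathfrak A\subseteq\mathcal P(A)$, $\mathfrak A^{\perp}=\{a'\subseteq A:\ a\cap a'\text{ finite for all }a\in\mathfrak A\}$; a finiteness structure on $A$ is $\mathfrak A$ with $\mathfrak A^{\perp\perp}=\mathfrak A$; a finiteness space $\mathcal A=(|\mathcal A|,\mathfrak F(\mathcal A))$ is a set with a finiteness structure on it. Finiteness extension: $\mathcal A\preceq\mathcal B$ iff $|\mathcal A|\subseteq|\mathcal B|$ and $\mathfrak F(\mathcal A)=\mathfrak F(\mathcal B)\cap\mathcal P(|\mathcal A|)$. The supremum (for finiteness inclusion) of a family $(\mathcal A_k)_k$ is the space with web $\bigcup_k|\mathcal A_k|$ and finiteness structure $(\bigcup_k\mathfrak F(\mathcal A_k))^{\perp\perp}$ (preduals on the union web); it is called exact when $\bigcup_k\mathfrak F(\mathcal A_k)$ is already a finiteness structure on $\bigcup_k|\mathcal A_k|$. -}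

module Defs where

open import Level using (0ℓ)
open import Data.Nat using (ℕ; suc)
open import Data.List using (List)
open import Data.List.Membership.Propositional using (_∈_)
open import Data.Product using (Σ; ∃; _×_)

-- Subsets of an ambient type X (all webs live inside X), as predicates.
Subset : Set → Set₁
Subset X = X → Set

Coll : Set → Set₂
Coll X = Subset X → Set₁

module _ {X : Set} where

  _⊆_ : Subset X → Subset X → Set
  a ⊆ b = ∀ {x} → a x → b x

  _∩_ : Subset X → Subset X → Subset X
  (a ∩ b) x = a x × b x

  Finite : Subset X → Set
  Finite a = Σ (List X) λ xs → ∀ x → a x → x ∈ xs

  perp : Subset X → Coll X → Coll X
  perp A 𝔄 a' = (a' ⊆ A) × (∀ a → 𝔄 a → Finite (a ∩ a'))

  IsFinStructure : Subset X → Coll X → Set₁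
  IsFinStructure A 𝔄 = (∀ a → 𝔄 a → perp A (perp A 𝔄) a)
                     × (∀ a → perp A (perp A 𝔄) a → 𝔄 a)

record FinSpace (X : Set) : Set₂ where
  field
    web : Subset X
    𝔉   : Coll X
    isFinStructure : IsFinStructure web 𝔉

open FinSpace public

_≼_ : {X : Set} → FinSpace X → FinSpace X → Set₁
𝒜 ≼ ℬ = (web 𝒜 ⊆ web ℬ)
      × (∀ a → (𝔉 𝒜 a → 𝔉 ℬ a × a ⊆ web 𝒜) × (𝔉 ℬ a × a ⊆ web 𝒜 → 𝔉 𝒜 a))

⋃web : {X : Set} → (ℕ → FinSpace X) → Subset X
⋃web 𝒜 x = ∃ λ n → web (𝒜 n) x

⋃𝔉 : {X : Set} → (ℕ → FinSpace X) → Coll X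
⋃𝔉 𝒜 a = ∃ λ n → 𝔉 (𝒜 n) a

module Submission where

-- Write Wₙ and 𝔉ₙ for the web and finiteness structure of 𝒜ₙ, U = ⋃ Wₙ and
-- 𝔘 = ⋃ 𝔉ₙ.  Every collection of subsets of U lies in its biorthogonal, so
-- only 𝔘^⊥⊥ ⊆ 𝔘 needs an argument, which has two steps.
--  * Boundedness: every a ∈ 𝔘^⊥⊥ lies inside a single web W_N.  Otherwise
--    (classically) pick x_N ∈ a \ W_N for every N.  Since the webs increase,
--    a' = {x_N} meets every W_k, hence every member of 𝔘, in a finite set,
--    so a' ∈ 𝔘^⊥ and a ∩ a' = a' is finite; but a finite subset of U sits
--    inside one web W_k, which x_k avoids.
--  * Restriction: if a ⊆ W_N, every b ∈ 𝔉_N^⊥ is in 𝔘^⊥, because a member f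
--    of 𝔉_k meets W_N in a member of 𝔉_N (𝒜_N ≼ 𝒜_{N⊔k}).  Hence a ∈ 𝔉_N^⊥⊥ = 𝔉_N.

open import Defs
import Level
open import Level using (0ℓ; lift; lower)
open import Data.Nat using (ℕ; suc; _≤_; _<_; _≤′_; ≤′-refl; ≤′-step; _⊔_; _<?_)
open import Data.Nat.Properties using (≤⇒≤′; m≤m⊔n; m≤n⊔m; ≮⇒≥)
open import Data.List using (List; []; _∷_; applyUpTo)
open import Data.List.Membership.Propositional using (_∈_)
open import Data.List.Membership.Propositional.Properties using (∈-applyUpTo⁺)
open import Data.List.Relation.Unary.Any using (here; there)
open import Data.Product using (∃; _×_; _,_; proj₁; proj₂; swap)
open import Relation.Nullary using (¬_; yes; no)
open import Relation.Nullary.Decidable using (map′)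
open import Relation.Nullary.Negation using (contradiction)
open import Relation.Binary.PropositionalEquality using (_≡_; refl)
open import Axiom.ExcludedMiddle using (ExcludedMiddle)
open import Axiom.DoubleNegationElimination using (DoubleNegationElimination; em⇒dne)

lower-em : ExcludedMiddle (Level.suc 0ℓ) → ExcludedMiddle 0ℓ
lower-em em = map′ lower lift em

Finite-⊆ : {X : Set} {p q : Subset X} → p ⊆ q → Finite q → Finite p
Finite-⊆ p⊆q (xs , cover) = xs , λ x px → cover x (p⊆q px)

module _ {X : Set} {A : Subset X} {𝔄 : Coll X} where

  ⊆-perp-perp : (∀ a → 𝔄 a → a ⊆ A) → ∀ a → 𝔄 a → perp A (perp A 𝔄) a
  ⊆-perp-perp inA a 𝔄a = inA a 𝔄a , λ a' a'⊥ → Finite-⊆ swap (proj₂ a'⊥ a 𝔄a)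

  fs-⊆web : IsFinStructure A 𝔄 → ∀ {a} → 𝔄 a → a ⊆ A
  fs-⊆web (⊆⊥⊥ , _) {a} 𝔄a = proj₁ (⊆⊥⊥ a 𝔄a)

  fs-↓ : IsFinStructure A 𝔄 → ∀ {f g} → 𝔄 f → g ⊆ f → 𝔄 g
  fs-↓ (⊆⊥⊥ , ⊥⊥⊆) {f} {g} 𝔄f g⊆f =
    ⊥⊥⊆ g ( (λ gx → proj₁ (⊆⊥⊥ f 𝔄f) (g⊆f gx))
          , λ b b⊥ → Finite-⊆ (λ (bx , gx) → bx , g⊆f gx) (proj₂ (⊆⊥⊥ f 𝔄f) b b⊥))

module _ {X : Set} where

  private
    variable
      𝒜 ℬ 𝒞 : FinSpace X

  ≼-web : 𝒜 ≼ ℬ → web 𝒜 ⊆ web ℬ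
  ≼-web = proj₁

  ≼-extend : 𝒜 ≼ ℬ → ∀ {a} → 𝔉 𝒜 a → 𝔉 ℬ a
  ≼-extend (_ , rel) {a} 𝔉a = proj₁ (proj₁ (rel a) 𝔉a)

  ≼-restrict : 𝒜 ≼ ℬ → ∀ {a} → 𝔉 ℬ a → a ⊆ web 𝒜 → 𝔉 𝒜 a
  ≼-restrict (_ , rel) {a} 𝔉a a⊆ = proj₂ (rel a) (𝔉a , a⊆)

  -- ≼ is a preorder.  (Its type only mentions fields of the spaces, so the
  -- spaces cannot be inferred from a proof of 𝒜 ≼ ℬ and are passed explicitly.)
  ≼-trans : 𝒜 ≼ ℬ → ℬ ≼ 𝒞 → 𝒜 ≼ 𝒞
  ≼-trans {𝒜} {ℬ} {𝒞} 𝒜≼ℬ ℬ≼𝒞 = web-⊆ , λ a → (λ 𝔉a → from-𝒜 𝔉a , ⊆web 𝔉a) , to-𝒜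
    where
      web-⊆ : web 𝒜 ⊆ web 𝒞
      web-⊆ x∈𝒜 = ≼-web {ℬ} {𝒞} ℬ≼𝒞 (≼-web {𝒜} {ℬ} 𝒜≼ℬ x∈𝒜)

      from-𝒜 : ∀ {a} → 𝔉 𝒜 a → 𝔉 𝒞 a
      from-𝒜 𝔉a = ≼-extend {ℬ} {𝒞} ℬ≼𝒞 (≼-extend {𝒜} {ℬ} 𝒜≼ℬ 𝔉a)

      ⊆web : ∀ {a} → 𝔉 𝒜 a → a ⊆ web 𝒜
      ⊆web = fs-⊆web (isFinStructure 𝒜)

      to-𝒜 : ∀ {a} → 𝔉 𝒞 a × a ⊆ web 𝒜 → 𝔉 𝒜 a
      to-𝒜 (𝔉a , a⊆) =
        ≼-restrict {𝒜} {ℬ} 𝒜≼ℬ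
          (≼-restrict {ℬ} {𝒞} ℬ≼𝒞 𝔉a (λ ax → ≼-web {𝒜} {ℬ} 𝒜≼ℬ (a⊆ ax))) a⊆

  ≼-refl : 𝒜 ≼ 𝒜
  ≼-refl {𝒜} = (λ x → x) , λ a → (λ 𝔉a → 𝔉a , fs-⊆web (isFinStructure 𝒜) 𝔉a) , proj₁

≼-chain : {X : Set} (𝒜 : ℕ → FinSpace X) → (∀ n → 𝒜 n ≼ 𝒜 (suc n))
        → ∀ {m n} → m ≤ n → 𝒜 m ≼ 𝒜 n
≼-chain 𝒜 step m≤n = chain (≤⇒≤′ m≤n)
  where
    chain : ∀ {m n} → m ≤′ n → 𝒜 m ≼ 𝒜 n
    chain {m} ≤′-refl = ≼-refl {𝒜 = 𝒜 m}
    chain {m} {suc n} (≤′-step m≤′n) =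
      ≼-trans {𝒜 = 𝒜 m} {ℬ = 𝒜 n} {𝒞 = 𝒜 (suc n)} (chain m≤′n) (step n)

module IncreasingFamily (em : ExcludedMiddle 0ℓ) {X : Set} (W : ℕ → Subset X)
                        (W-mono : ∀ {m n} → m ≤ n → W m ⊆ W n) where

  dne : DoubleNegationElimination 0ℓ
  dne = em⇒dne em

  ⋃W : Subset X
  ⋃W x = ∃ λ n → W n x

  list-bounded : (L : List X) → ∃ λ k → ∀ {x} → x ∈ L → ⋃W x → W k x
  list-bounded [] = 0 , λ ()
  list-bounded (l ∷ L) with list-bounded L | em {⋃W l}
  ... | k , bound | yes (j , Wj-l) =
    k ⊔ j , λ { (here refl) _ → W-mono (m≤n⊔m k j) Wj-l
              ; (there x∈L) u → W-mono (m≤m⊔n k j) (bound x∈L u) }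
  ... | k , bound | no l∉⋃W =
    k , λ { (here refl) u → contradiction u l∉⋃W
          ; (there x∈L) u → bound x∈L u }

  finite-bounded : ∀ {a} → Finite a → a ⊆ ⋃W → ∃ λ k → a ⊆ W k
  finite-bounded (L , cover) a⊆⋃W with list-bounded L
  ... | k , bound = k , λ ax → bound (cover _ ax) (a⊆⋃W ax)

  ⊈-witness : ∀ {a b : Subset X} → ¬ (a ⊆ b) → ∃ λ x → a x × ¬ b x
  ⊈-witness a⊈b = dne λ none → a⊈b λ {x} ax → dne λ ¬bx → none (x , ax , ¬bx)

  -- Choosing x_N ∈ a \ W_N for an a escaping every W_N: the set {x_N} meets
  -- each W_k only in {x_N | N < k}, but is not finite.
  module Escaping (a : Subset X) (a⊆⋃W : a ⊆ ⋃W) (escapes : ∀ N → ¬ (a ⊆ W N)) where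

    point : ℕ → X
    point N = proj₁ (⊈-witness (escapes N))

    point-∉ : ∀ N → ¬ W N (point N)
    point-∉ N = proj₂ (proj₂ (⊈-witness (escapes N)))

    points : Subset X
    points y = ∃ λ N → point N ≡ y

    points-⊆ : points ⊆ a
    points-⊆ (N , refl) = proj₁ (proj₂ (⊈-witness (escapes N)))

    -- x_N ∈ W_k forces N < k, since otherwise W_k ⊆ W_N.
    index-below : ∀ {N k} → W k (point N) → N < k
    index-below {N} {k} Wk-xN with N <? k
    ... | yes N<k = N<k
    ... | no N≮k = contradiction (W-mono (≮⇒≥ N≮k) Wk-xN) (point-∉ N)

    points-thin : ∀ k → Finite (W k ∩ points)
    points-thin k = applyUpTo point k ,
      λ { _ (Wk-xN , N , refl) → ∈-applyUpTo⁺ point (index-below Wk-xN) }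

    -- A finite {x_N} would lie in some W_k, but x_k ∉ W_k.
    points-infinite : ¬ Finite points
    points-infinite fin with finite-bounded fin (λ y → a⊆⋃W (points-⊆ y))
    ... | k , ⊆Wk = point-∉ k (⊆Wk (k , refl))

  escaping-thin-subset : ∀ {a} → a ⊆ ⋃W → (∀ N → ¬ (a ⊆ W N))
                       → ∃ λ a' → a' ⊆ a × (∀ k → Finite (W k ∩ a')) × ¬ Finite a'
  escaping-thin-subset {a} a⊆⋃W escapes =
    points , points-⊆ , points-thin , points-infinite
    where open Escaping a a⊆⋃W escapes

module IncreasingUnion (em : ExcludedMiddle 0ℓ) {X : Set} (𝒜 : ℕ → FinSpace X)
                       (step : ∀ n → 𝒜 n ≼ 𝒜 (suc n)) where

  W : ℕ → Subset X
  W n = web (𝒜 n)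

  F : ℕ → Coll X
  F n = 𝔉 (𝒜 n)

  U : Subset X
  U = ⋃web 𝒜

  𝔘 : Coll X
  𝔘 = ⋃𝔉 𝒜

  web-mono : ∀ {m n} → m ≤ n → W m ⊆ W n
  web-mono {m} {n} m≤n = ≼-web {𝒜 = 𝒜 m} {ℬ = 𝒜 n} (≼-chain 𝒜 step m≤n)

  F-extend : ∀ {m n f} → m ≤ n → F m f → F n f
  F-extend {m} {n} m≤n = ≼-extend {𝒜 = 𝒜 m} {ℬ = 𝒜 n} (≼-chain 𝒜 step m≤n)

  F-restrict : ∀ {m n f} → m ≤ n → F n f → f ⊆ W m → F m f
  F-restrict {m} {n} m≤n = ≼-restrict {𝒜 = 𝒜 m} {ℬ = 𝒜 n} (≼-chain 𝒜 step m≤n)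

  F-⊆W : ∀ {n f} → F n f → f ⊆ W n
  F-⊆W {n} = fs-⊆web (isFinStructure (𝒜 n))

  open IncreasingFamily em W web-mono using (dne; escaping-thin-subset)

  𝔘-⊆U : ∀ a → 𝔘 a → a ⊆ U
  𝔘-⊆U a (n , Fa) ax = n , F-⊆W Fa ax

  thin-∈-perp : ∀ {a'} → a' ⊆ U → (∀ k → Finite (W k ∩ a')) → perp U 𝔘 a'
  thin-∈-perp a'⊆U thin =
    a'⊆U , λ { f (k , Ff) → Finite-⊆ (λ (fx , a'x) → F-⊆W Ff fx , a'x) (thin k) }

  perp-perp-bounded : ∀ {a} → perp U (perp U 𝔘) a → ∃ λ N → a ⊆ W N
  perp-perp-bounded (a⊆U , fin) = dne λ unbounded →
    let (a' , a'⊆a , thin , infinite) =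
          escaping-thin-subset a⊆U (λ N a⊆WN → unbounded (N , λ {x} → a⊆WN {x}))
    in infinite (Finite-⊆ (λ a'x → a'x , a'⊆a a'x)
                  (fin a' (thin-∈-perp (λ a'x → a⊆U (a'⊆a a'x)) thin)))

  ∩-web-∈ : ∀ N {k f} → F k f → F N (f ∩ W N)
  ∩-web-∈ N {k} Ff =
    F-restrict (m≤m⊔n N k)
      (fs-↓ (isFinStructure (𝒜 (N ⊔ k))) (F-extend (m≤n⊔m N k) Ff) proj₁)
      proj₂

  perp-F⊆perp-𝔘 : ∀ N {b} → perp (W N) (F N) b → perp U 𝔘 b
  perp-F⊆perp-𝔘 N (b⊆WN , fin) =
    (λ bx → N , b⊆WN bx) ,
    λ { f (k , Ff) → Finite-⊆ (λ (fx , bx) → (fx , b⊆WN bx) , bx)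
                              (fin (f ∩ W N) (∩-web-∈ N Ff)) }

  -- The nontrivial inclusion 𝔘^⊥⊥ ⊆ 𝔘: a ⊆ W_N and every b ∈ 𝔉_N^⊥ is in 𝔘^⊥,
  -- so a ∈ 𝔉_N^⊥⊥ = 𝔉_N.
  perp-perp⊆𝔘 : ∀ a → perp U (perp U 𝔘) a → 𝔘 a
  perp-perp⊆𝔘 a a⊥⊥ with perp-perp-bounded a⊥⊥
  ... | N , a⊆WN =
    N , proj₂ (isFinStructure (𝒜 N)) a
          (a⊆WN , λ b b⊥ → proj₂ a⊥⊥ b (perp-F⊆perp-𝔘 N b⊥))

lemma7 : ExcludedMiddle (Level.suc 0ℓ) → {X : Set} → (𝒜 : ℕ → FinSpace X)
    → (∀ n → 𝒜 n ≼ 𝒜 (suc n))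
    → IsFinStructure (⋃web 𝒜) (⋃𝔉 𝒜)
lemma7 em 𝒜 step = ⊆-perp-perp 𝔘-⊆U , perp-perp⊆𝔘
  where open IncreasingUnion (lower-em em) 𝒜 step
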